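{- Let $n\geq0$ and $\alpha=(\alpha_1,\dots,\alpha_n)\in\{0,1\}^n$, and let $k$ be the number of $i$ with $\alpha_i=1$. Then $$v_\alpha=\sum_{X\in B_q(n)}(-1)^{|S(\alpha)\cap P(X)|}\,q^{d(\alpha,X)}\,X.$$ In particular $v_\alpha(\{0\})=q^{k(n-k)}$ and $v_\alpha(\mathbb{F}_q^n)=(-1)^k$.
   Context: $q$ is a prime power. For $m\geq0$, $\mathbb{F}_q^m$ is the space of column vectors of length $m$ over $\mathbb{F}_q$; for $j<m$, $\mathbb{F}_q^j$ is identified with the subspace of $\mathbb{F}_q^m$ of vectors whose last $m-j$ coordinates vanish. $B_q(m)$ is the set of subspaces of $\mathbb{F}_q^m$; $\mathbb{C}[B_q(m)]$ is the complex vector space with basis $B_q(m)$, and $\mathbb{C}[B_q(m)]\subseteq\mathbb{C}[B_q(m+1)]$; for $v=\sum_Xv(X)X$, $v(X)$ are the coordinates. $A_q(m+1)=\{Y\in B_q(m+1):Y\not\subseteq\mathbb{F}_q^m\}$, and $\theta_m:\mathbb{C}[B_q(m)]\to\mathbb{C}[B_q(m+1)]$ is linear with $\theta_m(Z)=\sum Y$ over $Y\in A_q(m+1)$ with $Y\cap\mathbb{F}_q^m=Z$. For sequences in $\{0,1\}$ define $v_{()}=\{0\}\in\mathbb{C}[B_q(0)]$, and for $m\geq0$, $\beta\in\{0,1\}^m$ with $k'$ entries equal to $1$: $v_{(\beta,0)}=q^{k'}v_\beta+\theta_m(v_\beta)$ and $v_{(\beta,1)}=q^{m-k'}v_\beta-\theta_m(v_\beta)$,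 where $(\beta,a)$ is $\beta$ with $a$ appended. For $X\in B_q(n)$, $P(X)=\{j\in\{1,\dots,n\}: X\cap\mathbb{F}_q^j\not\subseteq\mathbb{F}_q^{j-1}\}$ (the pivotal indices of the matrix in column reduced echelon form whose column space is $X$). $S(\alpha)=\{i:\alpha_i=1\}$; $d(\alpha,i)=|\{j<i:\alpha_j\neq\alpha_i\}|$; $d(\alpha,X)=\sum_{i\in\{1,\dots,n\}\setminus P(X)}d(\alpha,i)$. -}

module Defs where

open import Level using (0ℓ)
open import Data.Bool using (Bool; true; false; if_then_else_; _∧_; _∨_; not; T)
open import Data.Bool.Properties using () renaming (_≟_ to _≟ᵇ_)
open import Data.Nat using (ℕ; zero; suc; _∸_; _<ᵇ_)
open import Data.Integer using (ℤ; +_; _*_; _-_; _^_; -_)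
open import Data.Fin using (Fin; toℕ)
open import Data.Vec using (Vec; []; _∷_; _∷ʳ_; init; last; zipWith; map; replicate; lookup; countᵇ; tabulate)
open import Data.List using (List; length; concatMap; allFin; filter)
open import Data.Nat.ListAction using (sum)
import Data.List as L
open import Data.List.Membership.Propositional using (_∈_)
open import Data.List.Relation.Unary.Unique.Propositional using (Unique)
open import Relation.Binary.PropositionalEquality using (_≡_)
open import Relation.Binary.Definitions using (DecidableEquality)
open import Relation.Nullary using (¬_; does)
open import Algebra.Structures using (IsCommutativeRing)
import Data.Product
import Data.Empty

-- A finite field 𝔽_q (equality is propositional equality).
-- q := number of elements; q is then automatically a prime power.

allᵇ : {A : Set} → (A → Bool) → List A → Bool
allᵇ p L.[] = true
allᵇ p (x L.∷ xs) = p x ∧ allᵇ p xs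

anyᵇ : {A : Set} → (A → Bool) → List A → Bool
anyᵇ p L.[] = false
anyᵇ p (x L.∷ xs) = p x ∨ anyᵇ p xs

record FiniteField : Set₁ where
  field
    Carrier : Set
    _+F_ _*F_ : Carrier → Carrier → Carrier
    -F_ : Carrier → Carrier
    0F 1F : Carrier
    isCommutativeRing : IsCommutativeRing _≡_ _+F_ _*F_ -F_ 0F 1F
    0≢1 : ¬ (0F ≡ 1F)
    _⁻¹ : Carrier → Carrier
    inverse : ∀ x → ¬ (x ≡ 0F) → x *F (x ⁻¹) ≡ 1F
    _≟_ : DecidableEquality Carrier
    elements : List Carrier
    complete : ∀ x → x ∈ elements
    unique : Unique elements

  q : ℕ
  q = length elements

module _ (F : FiniteField) where
  open FiniteField F

  Vecs : ℕ → Set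
  Vecs n = Vec Carrier n

  isZero : Carrier → Bool
  isZero x = does (x ≟ 0F)

  allVecs : (n : ℕ) → List (Vecs n)
  allVecs zero = [] L.∷ L.[]
  allVecs (suc n) = concatMap (λ x → L.map (x ∷_) (allVecs n)) elements

  -- B_q(n): subspaces of 𝔽_q^n, given by their (decidable) membership predicate
  record Subspace (n : ℕ) : Set where
    field
      mem : Vecs n → Bool
      zero-mem : mem (replicate n 0F) ≡ true
      add-mem : ∀ u w → mem u ≡ true → mem w ≡ true → mem (zipWith _+F_ u w) ≡ true
      smul-mem : ∀ c u → mem u ≡ true → mem (map (c *F_) u) ≡ true
  open Subspace public

  -- 𝔽_q^m ⊆ 𝔽_q^(m+1): vectors whose last coordinate vanishes.
  -- Y ⊆ 𝔽_q^m  (decided by enumeration)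
  insidePrev : ∀ {m} → Subspace (suc m) → Bool
  insidePrev {m} Y = allᵇ (λ v → not (mem Y v) ∨ isZero (last v)) (allVecs (suc m))

  restrict : ∀ {m} → Subspace (suc m) → Subspace m
  restrict Y = record
    { mem = λ v → mem Y (v ∷ʳ 0F)
    ; zero-mem = zm
    ; add-mem = λ u w p r → am u w p r
    ; smul-mem = λ c u p → sm c u p }
    where
    open import Relation.Binary.PropositionalEquality using (subst; sym; cong; trans)
    open IsCommutativeRing isCommutativeRing using (+-identityʳ; zeroʳ)
    rep : ∀ k → replicate k 0F ∷ʳ 0F ≡ replicate (suc k) 0F
    rep zero = Relation.Binary.PropositionalEquality.refl
    rep (suc k) = cong (0F ∷_) (rep k)
    zw : ∀ {k} (u w : Vecs k) → zipWith _+F_ u w ∷ʳ 0F ≡ zipWith _+F_ (u ∷ʳ 0F) (w ∷ʳ 0F)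
    zw [] [] = cong (_∷ []) (sym (+-identityʳ 0F))
    zw (x ∷ u) (y ∷ w) = cong ((x +F y) ∷_) (zw u w)
    mp : ∀ {k} c (u : Vecs k) → map (c *F_) u ∷ʳ 0F ≡ map (c *F_) (u ∷ʳ 0F)
    mp c [] = cong (_∷ []) (sym (zeroʳ c))
    mp c (x ∷ u) = cong ((c *F x) ∷_) (mp c u)
    zm = subst (λ z → mem Y z ≡ true) (sym (rep _)) (zero-mem Y)
    am = λ u w p r → subst (λ z → mem Y z ≡ true) (sym (zw u w)) (add-mem Y _ _ p r)
    sm = λ c u p → subst (λ z → mem Y z ≡ true) (sym (mp c u)) (smul-mem Y c _ p)

  qℤ : ℤ
  qℤ = + q

  ones : ∀ {m} → Vec Bool m → ℕ
  ones = countᵇ (λ b → b)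

  -- Coordinates v_β(Y) of v_β ∈ ℂ[B_q(m)].  The alphabet {0,1} is encoded
  -- as Bool with false = 0, true = 1.
  -- For β' of length m and Y ∈ B_q(m+1):
  --   (v_β' viewed in ℂ[B_q(m+1)])(Y) = v_β'(Y ∩ 𝔽_q^m) if Y ⊆ 𝔽_q^m, else 0;
  --   θ_m(v_β')(Y) = v_β'(Y ∩ 𝔽_q^m) if Y ⊄ 𝔽_q^m, else 0.
  vcoord : (m : ℕ) → Vec Bool m → Subspace m → ℤ
  vcoord zero [] Y = + 1
  vcoord (suc m) β Y =
    if last β
      then (qℤ ^ (m ∸ k')) * incl - θ
      else (qℤ ^ k') * incl + θ
    where
    β' = init β
    k' = ones β'
    open Data.Integer using (_+_)
    incl = if insidePrev Y then vcoord m β' (restrict Y) else + 0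
    θ = if insidePrev Y then + 0 else vcoord m β' (restrict Y)

  -- j ∈ P(X) (j = toℕ i + 1): X ∩ 𝔽_q^j ⊄ 𝔽_q^(j-1), i.e. some v ∈ X has
  -- v_k = 0 for all k > j and v_j ≠ 0.
  pivotal : ∀ {n} → Subspace n → Fin n → Bool
  pivotal {n} X i = anyᵇ (λ v → mem X v ∧ inFj v ∧ not (isZero (lookup v i))) (allVecs n)
    where
    inFj : Vecs n → Bool
    inFj v = allᵇ (λ k → not (toℕ i <ᵇ toℕ k) ∨ isZero (lookup v k)) (allFin n)

  sizeSP : ∀ {n} → Vec Bool n → Subspace n → ℕ
  sizeSP {n} α X = length (filter (λ i → T? (lookup α i ∧ pivotal X i)) (allFin n))
    where open import Relation.Nullary.Decidable using () renaming (T? to T?)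

  dαi : ∀ {n} → Vec Bool n → Fin n → ℕ
  dαi {n} α i = length (filter (λ j → T? ((toℕ j <ᵇ toℕ i) ∧ not (does (lookup α j ≟ᵇ lookup α i)))) (allFin n))
    where open import Relation.Nullary.Decidable using () renaming (T? to T?)

  dαX : ∀ {n} → Vec Bool n → Subspace n → ℕ
  dαX {n} α X = sum (L.map (λ i → if pivotal X i then 0 else dαi α i) (allFin n))

  isZeroVec : ∀ {n} → Vecs n → Bool
  isZeroVec [] = true
  isZeroVec (x ∷ v) = isZero x ∧ isZeroVec v

  private
    open import Relation.Binary.PropositionalEquality using (refl; cong₂)
    open IsCommutativeRing isCommutativeRing using (+-identityʳ; zeroʳ)
    ∧-split : ∀ {a b} → (a ∧ b) ≡ true → (a ≡ true) Data.Product.× (b ≡ true)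
    ∧-split {true} {true} refl = refl Data.Product., refl
    isZero-sound : ∀ x → isZero x ≡ true → x ≡ 0F
    isZero-sound x p with x ≟ 0F
    ... | Relation.Nullary.yes e = e
    isZero-sound x () | Relation.Nullary.no _
    isZero-0 : isZero 0F ≡ true
    isZero-0 with 0F ≟ 0F
    ... | Relation.Nullary.yes _ = refl
    ... | Relation.Nullary.no ne = Data.Empty.⊥-elim (ne refl)
    z0 : ∀ n → isZeroVec (replicate n 0F) ≡ true
    z0 zero = refl
    z0 (suc n) = cong₂ _∧_ isZero-0 (z0 n)
    zadd : ∀ {n} (u w : Vecs n) → isZeroVec u ≡ true → isZeroVec w ≡ true → isZeroVec (zipWith _+F_ u w) ≡ true
    zadd [] [] _ _ = refl
    zadd (x ∷ u) (y ∷ w) p r with ∧-split {isZero x} p | ∧-split {isZero y} r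
    ... | (px Data.Product., pu) | (py Data.Product., pw)
      rewrite isZero-sound x px | isZero-sound y py | +-identityʳ 0F = cong₂ _∧_ isZero-0 (zadd u w pu pw)
    zsm : ∀ {n} c (u : Vecs n) → isZeroVec u ≡ true → isZeroVec (map (c *F_) u) ≡ true
    zsm c [] _ = refl
    zsm c (x ∷ u) p with ∧-split {isZero x} p
    ... | (px Data.Product., pu) rewrite isZero-sound x px | zeroʳ c = cong₂ _∧_ isZero-0 (zsm c u pu)

  zeroSub : (n : ℕ) → Subspace n
  zeroSub n = record
    { mem = isZeroVec
    ; zero-mem = z0 n ; add-mem = zadd ; smul-mem = zsm }

  fullSub : (n : ℕ) → Subspace n
  fullSub n = record
    { mem = λ _ → true
    ; zero-mem = Relation.Binary.PropositionalEquality.refl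
    ; add-mem = λ _ _ _ _ → Relation.Binary.PropositionalEquality.refl
    ; smul-mem = λ _ _ _ → Relation.Binary.PropositionalEquality.refl }

-- Induction on n, splitting α = (β, a) with β of length m and k' ones.  For Y ∈ B_q(m+1)
-- the recursion reads v_α(Y) = v_β(Y ∩ 𝔽_q^m) · c, where c = q^{k'} or q^{m-k'} (for a = 0, 1)
-- if Y ⊆ 𝔽_q^m, and c = 1 or −1 otherwise.  On the other side, the pivots of Y below m+1
-- are exactly those of Y ∩ 𝔽_q^m, m+1 is a pivot iff Y ⊄ 𝔽_q^m, and d(α, m+1) is the number
-- of j ≤ m with α_j ≠ a, i.e. k' or m − k'.  So passing from (β, Y ∩ 𝔽_q^m) to (α, Y) adds
-- 1 to |S(α) ∩ P(Y)| exactly when c = −1, and adds the exponent of c to d(α, Y).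
module Submission where

open import Defs
open import Data.Nat using (ℕ; _*_; _∸_)
open import Data.Integer using (ℤ; +_; -_; _^_) renaming (_*_ to _*ℤ_)
open import Data.Vec using (Vec)
open import Data.Bool using (Bool)
open import Data.Product using (_×_)
open import Relation.Binary.PropositionalEquality using (_≡_)

open import Data.Nat using (zero; suc; _+_; _≤_; _<_; _<ᵇ_)
open import Data.Integer using (_-_) renaming (_+_ to _+ℤ_)
import Data.Nat.Properties as ℕₚ
import Data.Integer.Properties as ℤₚ
open import Algebra.Properties.CommutativeSemigroup ℤₚ.*-commutativeSemigroup using (interchange)
open import Algebra.Properties.Monoid.Sum ℕₚ.+-0-monoid using (sum-cong-≗; sum-init-last)
  renaming (sum to ∑)
open import Data.Bool using (true; false; if_then_else_; _∧_; _∨_; not)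
open import Data.Bool.Properties using (T-≡; ¬-not; if-not; ∧-zeroʳ; ∧-identityʳ)
  renaming (_≟_ to _≟ᵇ_)
open import Data.Fin using (Fin; toℕ; inject₁; fromℕ)
open import Data.Fin.Properties using (toℕ-inject₁; toℕ-fromℕ; toℕ<n; ≤fromℕ)
open import Data.Vec using ([]; _∷_; _∷ʳ_; init; last; lookup; replicate; initLast)
open import Data.Vec.Properties using (init-∷ʳ; last-∷ʳ; count≤n)
import Data.List as L
open import Data.List using (allFin; filter; length)
open import Data.List.Properties using (map-tabulate)
open import Data.Nat.ListAction using (sum)
open import Data.List.Membership.Propositional using (_∈_; lose)
open import Data.List.Membership.Propositional.Properties using (∈-concatMap⁺; ∈-map⁺; ∈-allFin)
open import Data.List.Relation.Unary.Any using (here; there)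
open import Data.Product using (∃; _,_; proj₁; proj₂)
open import Data.Empty using (⊥-elim)
open import Function using (_∘_; id)
open import Function.Bundles using (Equivalence)
open import Relation.Binary.PropositionalEquality
  using (_≢_; refl; sym; trans; cong; cong₂; subst; subst₂; module ≡-Reasoning)
open import Relation.Nullary using (does; yes)
open import Relation.Nullary.Decidable using (T?; dec-true; dec-false)

open Equivalence using (to; from)

∧-true⁻ : ∀ {a b} → a ∧ b ≡ true → a ≡ true × b ≡ true
∧-true⁻ {true} {true} refl = refl , refl

not∨-elim : ∀ {a b} → not a ∨ b ≡ true → a ≡ true → b ≡ true
not∨-elim {true} b≡true refl = b≡true

not∨-intro : ∀ {a b} → (a ≡ true → b ≡ true) → not a ∨ b ≡ true
not∨-intro {true} h = h refl
not∨-intro {false} h = refl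

not∨-false⁻ : ∀ {a b} → not a ∨ b ≡ false → a ≡ true × b ≡ false
not∨-false⁻ {true} {false} refl = refl , refl

not≡true⇒≡false : ∀ {a} → not a ≡ true → a ≡ false
not≡true⇒≡false {false} refl = refl

≡true-ext : ∀ {a b} → (a ≡ true → b ≡ true) → (b ≡ true → a ≡ true) → a ≡ b
≡true-ext {true} a⇒b b⇒a = sym (a⇒b refl)
≡true-ext {false} {true} a⇒b b⇒a = b⇒a refl
≡true-ext {false} {false} a⇒b b⇒a = refl

<⇒<ᵇ≡true : ∀ {m n} → m < n → (m <ᵇ n) ≡ true
<⇒<ᵇ≡true = to T-≡ ∘ ℕₚ.<⇒<ᵇ

<ᵇ≡true⇒< : ∀ {m n} → (m <ᵇ n) ≡ true → m < n
<ᵇ≡true⇒< {m} {n} = ℕₚ.<ᵇ⇒< m n ∘ from T-≡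

≤⇒<ᵇ≡false : ∀ {m n} → n ≤ m → (m <ᵇ n) ≡ false
≤⇒<ᵇ≡false n≤m = ¬-not (λ m<ᵇn → ℕₚ.<⇒≱ (<ᵇ≡true⇒< m<ᵇn) n≤m)

module _ {A : Set} where

  anyᵇ-sound : ∀ (p : A → Bool) xs → anyᵇ p xs ≡ true → ∃ λ x → p x ≡ true
  anyᵇ-sound p (x L.∷ xs) any≡true with p x in px
  ... | true = x , px
  ... | false = anyᵇ-sound p xs any≡true

  anyᵇ-complete : ∀ (p : A → Bool) {xs x} → x ∈ xs → p x ≡ true → anyᵇ p xs ≡ true
  anyᵇ-complete p (here refl) px rewrite px = refl
  anyᵇ-complete p {y L.∷ _} (there x∈xs) px with p y
  ... | true = refl
  ... | false = anyᵇ-complete p x∈xs px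

  allᵇ-sound : ∀ (p : A → Bool) {xs x} → allᵇ p xs ≡ true → x ∈ xs → p x ≡ true
  allᵇ-sound p all≡true (here refl) = proj₁ (∧-true⁻ all≡true)
  allᵇ-sound p {y L.∷ _} all≡true (there x∈xs) =
    allᵇ-sound p (proj₂ (∧-true⁻ {p y} all≡true)) x∈xs

  allᵇ-complete : ∀ (p : A → Bool) xs → (∀ x → p x ≡ true) → allᵇ p xs ≡ true
  allᵇ-complete p L.[] h = refl
  allᵇ-complete p (x L.∷ xs) h rewrite h x = allᵇ-complete p xs h

  allᵇ-false : ∀ (p : A → Bool) xs → allᵇ p xs ≡ false → ∃ λ x → p x ≡ false
  allᵇ-false p (x L.∷ xs) all≡false with p x in px
  ... | true = allᵇ-false p xs all≡false
  ... | false = x , px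

  allᵇ-cong : ∀ {p r : A → Bool} xs → (∀ x → p x ≡ r x) → allᵇ p xs ≡ allᵇ r xs
  allᵇ-cong L.[] h = refl
  allᵇ-cong (x L.∷ xs) h = cong₂ _∧_ (h x) (allᵇ-cong xs h)

  init-∷ʳ-last : ∀ {m} (v : Vec A (suc m)) → init v ∷ʳ last v ≡ v
  init-∷ʳ-last v = sym (proj₂ (proj₂ (initLast v)))

  lookup-inject₁ : ∀ {m} (v : Vec A (suc m)) (k : Fin m) → lookup v (inject₁ k) ≡ lookup (init v) k
  lookup-inject₁ (x ∷ v) Fin.zero = refl
  lookup-inject₁ (x ∷ v) (Fin.suc k) = lookup-inject₁ v k

  lookup-fromℕ : ∀ {m} (v : Vec A (suc m)) → lookup v (fromℕ m) ≡ last v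
  lookup-fromℕ (x ∷ []) = refl
  lookup-fromℕ (x ∷ y ∷ v) = lookup-fromℕ (y ∷ v)

data InjectOrLast : ∀ {m} → Fin (suc m) → Set where
  inject : ∀ {m} (k : Fin m) → InjectOrLast (inject₁ k)
  final : ∀ {m} → InjectOrLast (fromℕ m)

injectOrLast : ∀ {m} (k : Fin (suc m)) → InjectOrLast k
injectOrLast {zero} Fin.zero = final
injectOrLast {suc m} Fin.zero = inject Fin.zero
injectOrLast {suc m} (Fin.suc k) with injectOrLast k
... | inject j = inject (Fin.suc j)
... | final = final

iverson : Bool → ℕ
iverson true = 1
iverson false = 0

sum-tabulate : ∀ {m} (g : Fin m → ℕ) → sum (L.tabulate g) ≡ ∑ g
sum-tabulate {zero} g = refl
sum-tabulate {suc m} g = cong (_+_ (g Fin.zero)) (sum-tabulate (g ∘ Fin.suc))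

sum-map-allFin : ∀ {m} (g : Fin m → ℕ) → sum (L.map g (allFin m)) ≡ ∑ g
sum-map-allFin g = trans (cong sum (map-tabulate id g)) (sum-tabulate g)

length-filter-sum : ∀ {A : Set} (f : A → Bool) xs →
  length (filter (T? ∘ f) xs) ≡ sum (L.map (iverson ∘ f) xs)
length-filter-sum f L.[] = refl
length-filter-sum f (x L.∷ xs) with f x
... | true = cong suc (length-filter-sum f xs)
... | false = length-filter-sum f xs

length-filter-allFin : ∀ {m} (f : Fin m → Bool) →
  length (filter (T? ∘ f) (allFin m)) ≡ ∑ (iverson ∘ f)
length-filter-allFin {m} f = trans (length-filter-sum f (allFin m)) (sum-map-allFin (iverson ∘ f))

-- The number of j ≤ m with β_j ≠ a, for β of length m with k ones.
disagreements : Bool → ℕ → ℕ → ℕ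
disagreements true m k = m ∸ k
disagreements false m k = k

k*[m∸k]-step : ∀ a {m k} → k ≤ m →
  k * (m ∸ k) + disagreements a m k ≡ (k + iverson a) * (suc m ∸ (k + iverson a))
k*[m∸k]-step true {m} {k} k≤m rewrite ℕₚ.+-comm k 1 = ℕₚ.+-comm (k * (m ∸ k)) (m ∸ k)
k*[m∸k]-step false {m} {k} k≤m rewrite ℕₚ.+-identityʳ k | ℕₚ.+-∸-assoc 1 k≤m =
  trans (ℕₚ.+-comm (k * (m ∸ k)) k) (sym (ℕₚ.*-suc k (m ∸ k)))

module _ (F : FiniteField) where
  open FiniteField F

  isZero-true⇒ : ∀ {x} → isZero F x ≡ true → x ≡ 0F
  isZero-true⇒ {x} isZero≡true with x ≟ 0F
  ... | yes x≡0 = x≡0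

  isZero-false⇒ : ∀ {x} → isZero F x ≡ false → x ≢ 0F
  isZero-false⇒ {x} isZero≡false x≡0 with trans (sym isZero≡false) (dec-true (x ≟ 0F) x≡0)
  ... | ()

  allVecs-complete : ∀ {n} (v : Vecs F n) → v ∈ allVecs F n
  allVecs-complete [] = here refl
  allVecs-complete {suc n} (x ∷ v) =
    ∈-concatMap⁺ (λ y → L.map (y ∷_) (allVecs F n))
      (lose (complete x) (∈-map⁺ (x ∷_) (allVecs-complete v)))

  insidePrev-true⇒ : ∀ {m} {Y : Subspace F (suc m)} → insidePrev F Y ≡ true →
    ∀ {v} → mem Y v ≡ true → last v ≡ 0F
  insidePrev-true⇒ inside {v} v∈Y =
    isZero-true⇒ (not∨-elim (allᵇ-sound _ inside (allVecs-complete v)) v∈Y)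

  ⇒insidePrev-true : ∀ {m} {Y : Subspace F (suc m)} →
    (∀ v → mem Y v ≡ true → last v ≡ 0F) → insidePrev F Y ≡ true
  ⇒insidePrev-true {m} h =
    allᵇ-complete _ (allVecs F (suc m)) (λ v → not∨-intro (dec-true (last v ≟ 0F) ∘ h v))

  insidePrev-false⇒ : ∀ {m} {Y : Subspace F (suc m)} → insidePrev F Y ≡ false →
    ∃ λ v → mem Y v ≡ true × last v ≢ 0F
  insidePrev-false⇒ {m} outside with allᵇ-false _ (allVecs F (suc m)) outside
  ... | v , p with not∨-false⁻ p
  ... | v∈Y , last≢0 = v , v∈Y , isZero-false⇒ last≢0

  -- The Boolean conjunct of `pivotal` expressing v ∈ 𝔽_q^(i+1), with i counted from 0.
  vanishesAboveᵇ : ∀ {n} → Fin n → Vecs F n → Bool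
  vanishesAboveᵇ {n} i v = allᵇ (λ k → not (toℕ i <ᵇ toℕ k) ∨ isZero F (lookup v k)) (allFin n)

  record PivotVector {n} (X : Subspace F n) (i : Fin n) : Set where
    constructor pivotVector
    field
      vector : Vecs F n
      ∈X : mem X vector ≡ true
      vanishes-above : ∀ k → toℕ i < toℕ k → lookup vector k ≡ 0F
      pivot≢0 : lookup vector i ≢ 0F

  pivotal⇒PivotVector : ∀ {n} {X : Subspace F n} {i} → pivotal F X i ≡ true → PivotVector X i
  pivotal⇒PivotVector {n} {X} {i} piv with anyᵇ-sound _ (allVecs F n) piv
  ... | v , p with ∧-true⁻ {mem X v} p
  ... | v∈X , q with ∧-true⁻ {vanishesAboveᵇ i v} q
  ... | vanishes , nonzero = pivotVector v v∈X
    (λ k i<k → isZero-true⇒ (not∨-elim (allᵇ-sound _ vanishes (∈-allFin k)) (<⇒<ᵇ≡true i<k)))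
    (isZero-false⇒ (not≡true⇒≡false nonzero))

  PivotVector⇒pivotal : ∀ {n} {X : Subspace F n} {i} → PivotVector X i → pivotal F X i ≡ true
  PivotVector⇒pivotal {n} {X} {i} (pivotVector v v∈X vanishes nonzero) =
    anyᵇ-complete _ (allVecs-complete v)
      (cong₂ _∧_ v∈X (cong₂ _∧_ vanishesᵇ (cong not (dec-false (lookup v i ≟ 0F) nonzero))))
    where
    vanishesᵇ : vanishesAboveᵇ i v ≡ true
    vanishesᵇ = allᵇ-complete _ (allFin n)
      (λ k → not∨-intro (dec-true (lookup v k ≟ 0F) ∘ vanishes k ∘ <ᵇ≡true⇒<))

  pivotal-inject₁ : ∀ {m} (X : Subspace F (suc m)) (i : Fin m) →
    pivotal F X (inject₁ i) ≡ pivotal F (restrict F X) i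
  pivotal-inject₁ {m} X i = ≡true-ext
    (PivotVector⇒pivotal ∘ restrictPivot ∘ pivotal⇒PivotVector)
    (PivotVector⇒pivotal ∘ extendPivot ∘ pivotal⇒PivotVector)
    where
    inject₁-< : ∀ {j k : Fin m} → toℕ j < toℕ k → toℕ (inject₁ j) < toℕ (inject₁ k)
    inject₁-< = subst₂ _<_ (sym (toℕ-inject₁ _)) (sym (toℕ-inject₁ _))

    restrictPivot : PivotVector X (inject₁ i) → PivotVector (restrict F X) i
    restrictPivot (pivotVector v v∈X vanishes nonzero) =
      pivotVector (init v) (subst (λ u → mem X u ≡ true) (sym v≡) v∈X)
        (λ k i<k → trans (sym (lookup-inject₁ v k)) (vanishes (inject₁ k) (inject₁-< i<k)))
        (nonzero ∘ trans (lookup-inject₁ v i))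
      where
      last≡0 : last v ≡ 0F
      last≡0 = trans (sym (lookup-fromℕ v))
        (vanishes (fromℕ m) (subst₂ _<_ (sym (toℕ-inject₁ i)) (sym (toℕ-fromℕ m)) (toℕ<n i)))
      v≡ : init v ∷ʳ 0F ≡ v
      v≡ = trans (cong (init v ∷ʳ_) (sym last≡0)) (init-∷ʳ-last v)

    extendPivot : PivotVector (restrict F X) i → PivotVector X (inject₁ i)
    extendPivot (pivotVector w w∈ vanishes nonzero) =
      pivotVector (w ∷ʳ 0F) w∈ vanishes′ (nonzero ∘ trans (sym (lookup-∷ʳ i)))
      where
      lookup-∷ʳ : ∀ k → lookup (w ∷ʳ 0F) (inject₁ k) ≡ lookup w k
      lookup-∷ʳ k = trans (lookup-inject₁ (w ∷ʳ 0F) k) (cong (λ u → lookup u k) (init-∷ʳ 0F w))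
      vanishes′ : ∀ k → toℕ (inject₁ i) < toℕ k → lookup (w ∷ʳ 0F) k ≡ 0F
      vanishes′ k i<k with injectOrLast k
      ... | inject j = trans (lookup-∷ʳ j)
        (vanishes j (subst₂ _<_ (toℕ-inject₁ i) (toℕ-inject₁ j) i<k))
      ... | final = trans (lookup-fromℕ (w ∷ʳ 0F)) (last-∷ʳ 0F w)

  pivotal-fromℕ : ∀ {m} (X : Subspace F (suc m)) → pivotal F X (fromℕ m) ≡ not (insidePrev F X)
  pivotal-fromℕ {m} X with insidePrev F X in inside
  ... | true = ¬-not λ piv → let open PivotVector (pivotal⇒PivotVector {X = X} piv) in
    pivot≢0 (trans (lookup-fromℕ vector) (insidePrev-true⇒ {Y = X} inside ∈X))
  ... | false with insidePrev-false⇒ {Y = X} inside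
  ... | v , v∈X , last≢0 = PivotVector⇒pivotal {X = X} (pivotVector v v∈X
    (λ k m<k → ⊥-elim (ℕₚ.<⇒≱ m<k (≤fromℕ k)))
    (last≢0 ∘ trans (sym (lookup-fromℕ v))))

  ones-∷ʳ : ∀ {m} (β : Vec Bool m) a → ones F (β ∷ʳ a) ≡ ones F β + iverson a
  ones-∷ʳ [] true = refl
  ones-∷ʳ [] false = refl
  ones-∷ʳ (true ∷ β) a = cong suc (ones-∷ʳ β a)
  ones-∷ʳ (false ∷ β) a = ones-∷ʳ β a

  ones-init-last : ∀ {m} (α : Vec Bool (suc m)) → ones F α ≡ ones F (init α) + iverson (last α)
  ones-init-last α = trans (cong (ones F) (sym (init-∷ʳ-last α))) (ones-∷ʳ (init α) (last α))

  ones≤length : ∀ {m} (β : Vec Bool m) → ones F β ≤ m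
  ones≤length = count≤n (T? ∘ id)

  ∑-disagreements : ∀ {m} (β : Vec Bool m) a →
    ∑ (λ j → iverson (not (does (lookup β j ≟ᵇ a)))) ≡ disagreements a m (ones F β)
  ∑-disagreements [] true = refl
  ∑-disagreements [] false = refl
  ∑-disagreements (true ∷ β) true = ∑-disagreements β true
  ∑-disagreements (true ∷ β) false = cong suc (∑-disagreements β false)
  ∑-disagreements (false ∷ β) true =
    trans (cong suc (∑-disagreements β true)) (sym (ℕₚ.+-∸-assoc 1 (ones≤length β)))
  ∑-disagreements (false ∷ β) false = ∑-disagreements β false

  differsBefore : ∀ {n} → Vec Bool n → ℕ → Bool → Fin n → Bool
  differsBefore β t a j = (toℕ j <ᵇ t) ∧ not (does (lookup β j ≟ᵇ a))

  -- The last index never precedes i, so only init α matters on the left of i.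
  dαi-init : ∀ {m} (α : Vec Bool (suc m)) (i : Fin (suc m)) →
    dαi F α i ≡ ∑ (iverson ∘ differsBefore (init α) (toℕ i) (lookup α i))
  dαi-init {m} α i = begin
    dαi F α i                                          ≡⟨ length-filter-allFin d ⟩
    ∑ (iverson ∘ d)                                    ≡⟨ sum-init-last (iverson ∘ d) ⟩
    ∑ (iverson ∘ d ∘ inject₁) + iverson (d (fromℕ m))  ≡⟨ cong₂ _+_ (sum-cong-≗ d-inject₁) d-fromℕ ⟩
    ∑ (iverson ∘ d′) + 0                               ≡⟨ ℕₚ.+-identityʳ _ ⟩
    ∑ (iverson ∘ d′)                                   ∎
    where
    open ≡-Reasoning
    d = differsBefore α (toℕ i) (lookup α i)
    d′ = differsBefore (init α) (toℕ i) (lookup α i)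
    d-inject₁ : ∀ j → iverson (d (inject₁ j)) ≡ iverson (d′ j)
    d-inject₁ j = cong₂ (λ t x → iverson ((t <ᵇ toℕ i) ∧ not (does (x ≟ᵇ lookup α i))))
      (toℕ-inject₁ j) (lookup-inject₁ α j)
    d-fromℕ : iverson (d (fromℕ m)) ≡ 0
    d-fromℕ = cong (λ b → iverson (b ∧ not (does (lookup α (fromℕ m) ≟ᵇ lookup α i))))
      (≤⇒<ᵇ≡false (≤fromℕ i))

  dαi-inject₁ : ∀ {m} (α : Vec Bool (suc m)) (i : Fin m) → dαi F α (inject₁ i) ≡ dαi F (init α) i
  dαi-inject₁ α i = begin
    dαi F α (inject₁ i)
      ≡⟨ dαi-init α (inject₁ i) ⟩
    ∑ (iverson ∘ differsBefore (init α) (toℕ (inject₁ i)) (lookup α (inject₁ i)))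
      ≡⟨ cong₂ (λ t a → ∑ (iverson ∘ differsBefore (init α) t a)) (toℕ-inject₁ i) (lookup-inject₁ α i) ⟩
    ∑ (iverson ∘ differsBefore (init α) (toℕ i) (lookup (init α) i))
      ≡⟨ length-filter-allFin (differsBefore (init α) (toℕ i) (lookup (init α) i)) ⟨
    dαi F (init α) i ∎
    where open ≡-Reasoning

  dαi-fromℕ : ∀ {m} (α : Vec Bool (suc m)) →
    dαi F α (fromℕ m) ≡ disagreements (last α) m (ones F (init α))
  dαi-fromℕ {m} α = begin
    dαi F α (fromℕ m)
      ≡⟨ dαi-init α (fromℕ m) ⟩
    ∑ (iverson ∘ differsBefore (init α) (toℕ (fromℕ m)) (lookup α (fromℕ m)))
      ≡⟨ cong₂ (λ t a → ∑ (iverson ∘ differsBefore (init α) t a)) (toℕ-fromℕ m) (lookup-fromℕ α) ⟩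
    ∑ (iverson ∘ differsBefore (init α) m (last α))
      ≡⟨ sum-cong-≗ (λ j → cong (λ b → iverson (b ∧ differs j)) (<⇒<ᵇ≡true (toℕ<n j))) ⟩
    ∑ (iverson ∘ differs)
      ≡⟨ ∑-disagreements (init α) (last α) ⟩
    disagreements (last α) m (ones F (init α)) ∎
    where
    open ≡-Reasoning
    differs : Fin m → Bool
    differs j = not (does (lookup (init α) j ≟ᵇ last α))

  sizeSP-init-last : ∀ {m} (α : Vec Bool (suc m)) (X : Subspace F (suc m)) →
    sizeSP F α X ≡ sizeSP F (init α) (restrict F X) + iverson (last α ∧ not (insidePrev F X))
  sizeSP-init-last {m} α X = begin
    sizeSP F α X                                        ≡⟨ length-filter-allFin s ⟩
    ∑ (iverson ∘ s)                                     ≡⟨ sum-init-last (iverson ∘ s) ⟩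
    ∑ (iverson ∘ s ∘ inject₁) + iverson (s (fromℕ m))   ≡⟨ cong₂ _+_ (sum-cong-≗ s-inject₁) s-fromℕ ⟩
    ∑ (iverson ∘ s′) + iverson (last α ∧ not (insidePrev F X))
      ≡⟨ cong (_+ iverson (last α ∧ not (insidePrev F X))) (length-filter-allFin s′) ⟨
    sizeSP F (init α) (restrict F X) + iverson (last α ∧ not (insidePrev F X)) ∎
    where
    open ≡-Reasoning
    s : Fin (suc m) → Bool
    s i = lookup α i ∧ pivotal F X i
    s′ : Fin m → Bool
    s′ i = lookup (init α) i ∧ pivotal F (restrict F X) i
    s-inject₁ : ∀ i → iverson (s (inject₁ i)) ≡ iverson (s′ i)
    s-inject₁ i = cong₂ (λ a p → iverson (a ∧ p)) (lookup-inject₁ α i) (pivotal-inject₁ X i)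
    s-fromℕ : iverson (s (fromℕ m)) ≡ iverson (last α ∧ not (insidePrev F X))
    s-fromℕ = cong₂ (λ a p → iverson (a ∧ p)) (lookup-fromℕ α) (pivotal-fromℕ X)

  dαX-init-last : ∀ {m} (α : Vec Bool (suc m)) (X : Subspace F (suc m)) →
    dαX F α X ≡ dαX F (init α) (restrict F X)
      + (if insidePrev F X then disagreements (last α) m (ones F (init α)) else 0)
  dαX-init-last {m} α X = begin
    dαX F α X                               ≡⟨ sum-map-allFin t ⟩
    ∑ t                                     ≡⟨ sum-init-last t ⟩
    ∑ (t ∘ inject₁) + t (fromℕ m)           ≡⟨ cong₂ _+_ (sum-cong-≗ t-inject₁) t-fromℕ ⟩
    ∑ t′ + δ                                ≡⟨ cong (_+ δ) (sum-map-allFin t′) ⟨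
    dαX F (init α) (restrict F X) + δ       ∎
    where
    open ≡-Reasoning
    δ = if insidePrev F X then disagreements (last α) m (ones F (init α)) else 0
    t : Fin (suc m) → ℕ
    t i = if pivotal F X i then 0 else dαi F α i
    t′ : Fin m → ℕ
    t′ i = if pivotal F (restrict F X) i then 0 else dαi F (init α) i
    t-inject₁ : ∀ i → t (inject₁ i) ≡ t′ i
    t-inject₁ i = cong₂ (if_then 0 else_) (pivotal-inject₁ X i) (dαi-inject₁ α i)
    t-fromℕ : t (fromℕ m) ≡ δ
    t-fromℕ = trans (cong₂ (if_then 0 else_) (pivotal-fromℕ X) (dαi-fromℕ α))
                    (if-not (insidePrev F X))

  monomial : ℕ → ℕ → ℤ
  monomial s d = (- (+ 1)) ^ s *ℤ qℤ F ^ d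

  monomial-* : ∀ s d s′ d′ → monomial s d *ℤ monomial s′ d′ ≡ monomial (s + s′) (d + d′)
  monomial-* s d s′ d′ = trans (interchange ((- (+ 1)) ^ s) (qℤ F ^ d) ((- (+ 1)) ^ s′) (qℤ F ^ d′))
    (sym (cong₂ _*ℤ_ (ℤₚ.^-distribˡ-+-* (- (+ 1)) s s′) (ℤₚ.^-distribˡ-+-* (qℤ F) d d′)))

  -- v_(β,a)(Y) / v_β(Y ∩ 𝔽_q^m), where inside = [Y ⊆ 𝔽_q^m] and β has k ones.
  recurrenceFactor : (a inside : Bool) (m k : ℕ) → ℤ
  recurrenceFactor a inside m k =
    monomial (iverson (a ∧ not inside)) (if inside then disagreements a m k else 0)

  -- The left side is the defining clause of vcoord (suc m), with V = v_β(Y ∩ 𝔽_q^m).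
  recurrence≡*recurrenceFactor : ∀ a inside m k V →
    (if a then qℤ F ^ (m ∸ k) *ℤ (if inside then V else + 0) - (if inside then + 0 else V)
          else qℤ F ^ k *ℤ (if inside then V else + 0) +ℤ (if inside then + 0 else V))
      ≡ V *ℤ recurrenceFactor a inside m k
  recurrence≡*recurrenceFactor false true m k V =
    trans (ℤₚ.+-identityʳ _) (trans (ℤₚ.*-comm _ V) (cong (V *ℤ_) (sym (ℤₚ.*-identityˡ _))))
  recurrence≡*recurrenceFactor true true m k V =
    trans (ℤₚ.+-identityʳ _) (trans (ℤₚ.*-comm _ V) (cong (V *ℤ_) (sym (ℤₚ.*-identityˡ _))))
  recurrence≡*recurrenceFactor false false m k V =
    trans (cong (_+ℤ V) (ℤₚ.*-zeroʳ (qℤ F ^ k)))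
      (trans (ℤₚ.+-identityˡ V) (sym (ℤₚ.*-identityʳ V)))
  recurrence≡*recurrenceFactor true false m k V =
    trans (cong (_- V) (ℤₚ.*-zeroʳ (qℤ F ^ (m ∸ k))))
      (trans (ℤₚ.+-identityˡ (- V)) (trans (sym (ℤₚ.-1*i≡-i V)) (ℤₚ.*-comm (- (+ 1)) V)))

  vcoord-init-last : ∀ {m} (α : Vec Bool (suc m)) (Y : Subspace F (suc m)) →
    vcoord F (suc m) α Y
      ≡ vcoord F m (init α) (restrict F Y) *ℤ recurrenceFactor (last α) (insidePrev F Y) m (ones F (init α))
  vcoord-init-last {m} α Y = recurrence≡*recurrenceFactor
    (last α) (insidePrev F Y) m (ones F (init α)) (vcoord F m (init α) (restrict F Y))

  vcoord≡monomial : ∀ n (α : Vec Bool n) (X : Subspace F n) →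
    vcoord F n α X ≡ monomial (sizeSP F α X) (dαX F α X)
  vcoord≡monomial zero [] X = refl
  vcoord≡monomial (suc m) α X = begin
    vcoord F (suc m) α X                  ≡⟨ vcoord-init-last α X ⟩
    vcoord F m β X′ *ℤ monomial δs δd      ≡⟨ cong (_*ℤ monomial δs δd) (vcoord≡monomial m β X′) ⟩
    monomial s d *ℤ monomial δs δd        ≡⟨ monomial-* s d δs δd ⟩
    monomial (s + δs) (d + δd)            ≡⟨ cong₂ monomial (sizeSP-init-last α X) (dαX-init-last α X) ⟨
    monomial (sizeSP F α X) (dαX F α X)   ∎
    where
    open ≡-Reasoning
    β = init α
    X′ = restrict F X
    s = sizeSP F β X′
    d = dαX F β X′
    δs = iverson (last α ∧ not (insidePrev F X))
    δd = if insidePrev F X then disagreements (last α) m (ones F β) else 0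

  vcoord-resp-mem : ∀ {m} (β : Vec Bool m) {X Y : Subspace F m} →
    (∀ v → mem X v ≡ mem Y v) → vcoord F m β X ≡ vcoord F m β Y
  vcoord-resp-mem [] X≈Y = refl
  vcoord-resp-mem {suc m} β {X} {Y} X≈Y = begin
    vcoord F (suc m) β X
      ≡⟨ vcoord-init-last β X ⟩
    vcoord F m (init β) (restrict F X) *ℤ recurrenceFactor (last β) (insidePrev F X) m (ones F (init β))
      ≡⟨ cong₂ (λ V inside → V *ℤ recurrenceFactor (last β) inside m (ones F (init β)))
           (vcoord-resp-mem (init β) (X≈Y ∘ (_∷ʳ 0F)))
           (allᵇ-cong (allVecs F (suc m)) (λ v → cong (λ b → not b ∨ isZero F (last v)) (X≈Y v))) ⟩
    vcoord F m (init β) (restrict F Y) *ℤ recurrenceFactor (last β) (insidePrev F Y) m (ones F (init β))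
      ≡⟨ vcoord-init-last β Y ⟨
    vcoord F (suc m) β Y ∎
    where open ≡-Reasoning

  isZeroVec-∷ʳ0F : ∀ {n} (v : Vecs F n) → isZeroVec F (v ∷ʳ 0F) ≡ isZeroVec F v
  isZeroVec-∷ʳ0F [] = trans (∧-identityʳ _) (dec-true (0F ≟ 0F) refl)
  isZeroVec-∷ʳ0F (x ∷ v) = cong (isZero F x ∧_) (isZeroVec-∷ʳ0F v)

  isZeroVec⇒last≡0F : ∀ {m} (v : Vecs F (suc m)) → isZeroVec F v ≡ true → last v ≡ 0F
  isZeroVec⇒last≡0F (x ∷ []) v≡0 = isZero-true⇒ (proj₁ (∧-true⁻ v≡0))
  isZeroVec⇒last≡0F (x ∷ y ∷ v) v≡0 =
    isZeroVec⇒last≡0F (y ∷ v) (proj₂ (∧-true⁻ {isZero F x} v≡0))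

  insidePrev-zeroSub : ∀ m → insidePrev F (zeroSub F (suc m)) ≡ true
  insidePrev-zeroSub m = ⇒insidePrev-true {Y = zeroSub F (suc m)} isZeroVec⇒last≡0F

  insidePrev-fullSub : ∀ m → insidePrev F (fullSub F (suc m)) ≡ false
  insidePrev-fullSub m = ¬-not λ inside → 0≢1 (sym (trans (sym (last-∷ʳ 1F (replicate m 0F)))
    (insidePrev-true⇒ {Y = fullSub F (suc m)} inside refl)))

  vcoord-zeroSub : ∀ n (α : Vec Bool n) →
    vcoord F n α (zeroSub F n) ≡ monomial 0 (ones F α * (n ∸ ones F α))
  vcoord-zeroSub zero [] = refl
  vcoord-zeroSub (suc m) α = begin
    vcoord F (suc m) α O
      ≡⟨ vcoord-init-last α O ⟩
    vcoord F m β (restrict F O) *ℤ recurrenceFactor a (insidePrev F O) m k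
      ≡⟨ cong₂ (λ V inside → V *ℤ recurrenceFactor a inside m k)
           (vcoord-resp-mem β isZeroVec-∷ʳ0F) (insidePrev-zeroSub m) ⟩
    vcoord F m β (zeroSub F m) *ℤ recurrenceFactor a true m k
      ≡⟨ cong (_*ℤ recurrenceFactor a true m k) (vcoord-zeroSub m β) ⟩
    monomial 0 (k * (m ∸ k)) *ℤ monomial (iverson (a ∧ false)) (disagreements a m k)
      ≡⟨ monomial-* 0 (k * (m ∸ k)) (iverson (a ∧ false)) (disagreements a m k) ⟩
    monomial (iverson (a ∧ false)) (k * (m ∸ k) + disagreements a m k)
      ≡⟨ cong₂ monomial (cong iverson (∧-zeroʳ a)) (k*[m∸k]-step a (ones≤length β)) ⟩
    monomial 0 ((k + iverson a) * (suc m ∸ (k + iverson a)))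
      ≡⟨ cong (λ o → monomial 0 (o * (suc m ∸ o))) (ones-init-last α) ⟨
    monomial 0 (ones F α * (suc m ∸ ones F α)) ∎
    where
    open ≡-Reasoning
    O = zeroSub F (suc m)
    β = init α
    a = last α
    k = ones F β

  vcoord-fullSub : ∀ n (α : Vec Bool n) → vcoord F n α (fullSub F n) ≡ monomial (ones F α) 0
  vcoord-fullSub zero [] = refl
  vcoord-fullSub (suc m) α = begin
    vcoord F (suc m) α E
      ≡⟨ vcoord-init-last α E ⟩
    vcoord F m β (restrict F E) *ℤ recurrenceFactor a (insidePrev F E) m k
      ≡⟨ cong₂ (λ V inside → V *ℤ recurrenceFactor a inside m k)
           (vcoord-resp-mem β (λ _ → refl)) (insidePrev-fullSub m) ⟩
    vcoord F m β (fullSub F m) *ℤ recurrenceFactor a false m k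
      ≡⟨ cong (_*ℤ recurrenceFactor a false m k) (vcoord-fullSub m β) ⟩
    monomial k 0 *ℤ monomial (iverson (a ∧ true)) 0
      ≡⟨ monomial-* k 0 (iverson (a ∧ true)) 0 ⟩
    monomial (k + iverson (a ∧ true)) 0
      ≡⟨ cong (λ b → monomial (k + iverson b) 0) (∧-identityʳ a) ⟩
    monomial (k + iverson a) 0
      ≡⟨ cong (λ o → monomial o 0) (ones-init-last α) ⟨
    monomial (ones F α) 0 ∎
    where
    open ≡-Reasoning
    E = fullSub F (suc m)
    β = init α
    a = last α
    k = ones F β

theorem4p6 : (F : FiniteField) (n : ℕ) (α : Vec Bool n) →
    ((X : Subspace F n) →
      vcoord F n α X ≡ ((- (+ 1)) ^ sizeSP F α X) *ℤ (qℤ F ^ dαX F α X))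
    × (vcoord F n α (zeroSub F n) ≡ qℤ F ^ (ones F α * (n ∸ ones F α)))
    × (vcoord F n α (fullSub F n) ≡ (- (+ 1)) ^ ones F α)
theorem4p6 F n α =
    vcoord≡monomial F n α
  , trans (vcoord-zeroSub F n α) (ℤₚ.*-identityˡ _)
  , trans (vcoord-fullSub F n α) (ℤₚ.*-identityʳ _)
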